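{- Let $G$ be a graph of order $n$ with $\alpha(G)=4$. Then the independence polynomial $I(G^{*};x)$ is unimodal, and it has a mode $k$ satisfying \[ \left\lfloor \frac{n+1}{2}\right\rfloor \leq k\leq \left\lfloor \frac{n+1}{2}\right\rfloor +2. \] Moreover, if $n$ is odd, then it has a mode $k$ satisfying $\left\lfloor \frac{n+1}{2}\right\rfloor \leq k\leq \left\lfloor \frac{n+1}{2}\right\rfloor +1$.
   Context: All graphs are simple (finite, undirected, no loops or multiple edges). A stable set is a set of pairwise non-adjacent vertices; $\alpha(G)$ is the maximum size of a stable set in $G$. If $s_k$ denotes the number of stable sets of cardinality $k$ in $G$, the independence polynomial is $I(G;x)=\sum_{k=0}^{\alpha(G)} s_k x^k$. A sequence $a_0,\dots,a_n$ is unimodal if there is an index $k$ (called a mode) with $a_0\leq a_1\leq\cdots\leq a_k\geq a_{k+1}\geq\cdots\geq a_n$; a polynomial is unimodal if its coefficient sequence is, and its mode is the mode of that sequence. For a graph $G$ with vertex set $\{v_1,\dots,v_n\}$, $G^{*}$ is the graph obtained by adding $n$ new vertices $u_1,\dots,u_n$ and the edges $u_iv_i$ ($1\le i\le n$), i.e. appending a single pendant edge to each vertex of $G$. -}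

module Defs where

open import Data.Bool using (Bool; true; false; _∧_; not; if_then_else_)
open import Data.Nat using (ℕ; zero; suc; _+_; _≤_; _<_; _≡ᵇ_)
open import Data.Fin using (Fin; splitAt; _≟_)
open import Data.Sum using (inj₁; inj₂)
open import Data.Vec using (Vec; []; _∷_; lookup)
open import Data.List using (List; []; _∷_; map; _++_; filter; length; allFin)
open import Data.Bool.ListAction using (all)
open import Data.Fin.Subset using (Subset; ∣_∣)
open import Data.Product using (_×_; Σ)
open import Relation.Nullary.Decidable using (⌊_⌋)
open import Relation.Binary.PropositionalEquality using (_≡_)

Adj : ℕ → Set
Adj n = Fin n → Fin n → Bool

IsSimpleGraph : {n : ℕ} → Adj n → Set
IsSimpleGraph {n} adj = (∀ (i j : Fin n) → adj i j ≡ adj j i) × (∀ (i : Fin n) → adj i i ≡ false)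

allSubsets : (n : ℕ) → List (Subset n)
allSubsets zero = [] ∷ []
allSubsets (suc n) = map (true ∷_) (allSubsets n) ++ map (false ∷_) (allSubsets n)

isStable : {n : ℕ} → Adj n → Subset n → Bool
isStable {n} adj S =
  all (λ i → all (λ j → not (lookup S i ∧ lookup S j ∧ adj i j)) (allFin n)) (allFin n)

stableCount : {n : ℕ} → Adj n → ℕ → ℕ
stableCount {n} adj k =
  length (filter (λ S → (isStable adj S ∧ (∣ S ∣ ≡ᵇ k)) Data.Bool.≟ true) (allSubsets n))
  where import Data.Bool

IsIndependenceNumber : {n : ℕ} → Adj n → ℕ → Set
IsIndependenceNumber {n} adj a =
  Σ (Subset n) (λ S → (isStable adj S ≡ true) × (∣ S ∣ ≡ a))
  × (∀ (S : Subset n) → isStable adj S ≡ true → ∣ S ∣ ≤ a)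

-- G*: vertices 0..n-1 are v_i (original), n..2n-1 are u_i (pendant), u_i ~ v_i.
star : {n : ℕ} → Adj n → Adj (n + n)
star {n} adj x y with splitAt n x | splitAt n y
... | inj₁ i | inj₁ j = adj i j
... | inj₁ i | inj₂ j = ⌊ i ≟ j ⌋
... | inj₂ i | inj₁ j = ⌊ i ≟ j ⌋
... | inj₂ i | inj₂ j = false

IsMode : (ℕ → ℕ) → ℕ → ℕ → Set
IsMode a d k =
  k ≤ d
  × (∀ i → suc i ≤ k → a i ≤ a (suc i))
  × (∀ i → k ≤ i → suc i ≤ d → a (suc i) ≤ a i)

{-# OPTIONS --safe #-}
module Submission where

-- A stable set of G* splits as S ++ U, with S stable in G and U a set of pendant
-- vertices whose partners avoid S, so I(G*; x) = Σ x^|S| (1 + x)^(n - |S|) over the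
-- stable sets S of G. The summand for S peaks at (n + |S|)/2 and |S| ≤ 4, so the
-- coefficients s_j of I(G*; x) increase while 2j + 1 ≤ n and decrease once
-- 2j + 1 ≥ n + 4. For odd n = 2q + 1 this leaves a mode in {q + 1, q + 2}. For even
-- n = 2q the missing step s_q ≤ s_(q+1) holds because, going from x^q to x^(q+1), only
-- the summand of S = ∅ decreases, by the Catalan number C_q, while each of the
-- C(4,2) = 6 pairs inside a maximum stable set adds C_(q-1), and C_q ≤ 4 C_(q-1).

open import Defs
import Algebra.Properties.CommutativeSemigroup as CommSemigroupProperties
open import Data.Bool using (Bool; true; false; _∧_; not; T; if_then_else_)
import Data.Bool as Bool
open import Data.Bool.ListAction using (all)
open import Data.Bool.Properties using (T-≡; T-not-≡; ¬-not; not-¬)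
open import Data.Fin using (Fin; splitAt; _↑ˡ_; _↑ʳ_; _≟_)
open import Data.Fin.Properties using (splitAt-↑ˡ; splitAt-↑ʳ)
open import Data.Fin.Subset using (Subset; ∣_∣; _∈_; _⊆_; ∁; ⊥; ⊤)
open import Data.Fin.Subset.Properties
  using (_⊆?_; ⊆⊤; ∉⊥; x∈p⇒x∉∁p; x∉p⇒x∈∁p; ∣⊤∣≡n; ∣⊥∣≡0; ∣∁p∣≡n∸∣p∣; ∣p∣≤n)
open import Data.List as List using (List; []; _∷_; map; filter; length; allFin)
open import Data.List.Membership.Propositional.Properties using (∈-allFin)
import Data.List.Relation.Unary.All as All
open import Data.List.Relation.Unary.All.Properties using (all⁺; all⁻)
open import Data.List.Properties using (map-++; map-∘; map-cong)
open import Data.Nat using (ℕ; zero; suc; _+_; _*_; _∸_; _≤_; _<_; _≤?_; _≡ᵇ_; _/_; _%_; z≤n; s≤s; s≤s⁻¹)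
open import Data.Nat.Combinatorics using (_C_; nCk+nC[k+1]≡[n+1]C[k+1]; nCk≡nC[n∸k]; nC1≡n; k>n⇒nCk≡0)
open import Data.Nat.DivMod using (m/n≡1+[m∸n]/n)
open import Data.Nat.ListAction using (sum)
open import Data.Nat.ListAction.Properties using (sum-++)
open import Data.Nat.Properties
  using ( *-cancelˡ-≡; *-cancelˡ-≤; *-distribʳ-+; *-distribˡ-+; *-distribˡ-∸; *-identityʳ; *-identityˡ
        ; *-monoˡ-≤; *-zeroʳ; +-assoc; +-cancelʳ-≤; +-cancelˡ-≡; +-cancelˡ-≤; +-comm
        ; +-commutativeSemigroup; +-identityʳ; +-mono-≤; +-monoʳ-≤; +-monoˡ-≤; +-suc; <⇒≤
        ; m+[n∸m]≡n; m+n∸m≡n; m+n∸n≡m; m+n≤o⇒m≤o∸n; m<n⇒m<1+n; m∸n+n≡m; m≤m+n; m≤n+m; m≤n+m∸n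
        ; m≤n+o⇒m∸n≤o; m≤n⇒m<n∨m≡n; m≤n⇒m∸n≡0; n≤1+n; ≤-<-connex; ≤-refl; ≤-reflexive; ≤-trans
        ; ≰⇒>; suc-injective; module ≤-Reasoning)
open import Data.Nat.Tactic.RingSolver using (solve-∀)
open import Data.Product using (Σ; _×_; _,_; proj₁; proj₂)
open import Data.Sum using (inj₁; inj₂; [_,_]′)
open import Data.Vec using ([]; _∷_; _++_; lookup)
open import Data.Vec.Properties using ([]=⇒lookup; lookup⇒[]=; lookup-++ˡ; lookup-++ʳ; lookup-splitAt)
open import Function using (_∘_)
open import Function.Bundles using (Equivalence)
open import Relation.Binary.PropositionalEquality
open import Relation.Nullary.Decidable using (does; yes; no; dec-true; dec-false; isYes≗does)
open import Relation.Nullary.Negation using (contradiction)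

-- Sums over all subsets

𝟙 : Bool → ℕ
𝟙 true  = 1
𝟙 false = 0

𝟙[a∧b]≤𝟙[b] : ∀ a b → 𝟙 (a ∧ b) ≤ 𝟙 b
𝟙[a∧b]≤𝟙[b] true  b = ≤-refl
𝟙[a∧b]≤𝟙[b] false b = z≤n

module _ {a} {A : Set a} where

  length-filter-≡true : ∀ (p : A → Bool) xs →
    length (filter (λ x → p x Bool.≟ true) xs) ≡ sum (map (𝟙 ∘ p) xs)
  length-filter-≡true p []       = refl
  length-filter-≡true p (x ∷ xs) with p x
  ... | true  = cong suc (length-filter-≡true p xs)
  ... | false = length-filter-≡true p xs

  sum-map-0 : ∀ (xs : List A) → sum (map (λ _ → 0) xs) ≡ 0
  sum-map-0 []       = refl
  sum-map-0 (x ∷ xs) = sum-map-0 xs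

  sum-map-+ : ∀ (f g : A → ℕ) xs →
    sum (map (λ x → f x + g x) xs) ≡ sum (map f xs) + sum (map g xs)
  sum-map-+ f g []       = refl
  sum-map-+ f g (x ∷ xs) = trans (cong (f x + g x +_) (sum-map-+ f g xs))
                                 (+-interchange (f x) (g x) _ _)
    where open CommSemigroupProperties +-commutativeSemigroup
            renaming (interchange to +-interchange)

  sum-map-*ʳ : ∀ c (f : A → ℕ) xs → sum (map (λ x → f x * c) xs) ≡ sum (map f xs) * c
  sum-map-*ʳ c f []       = refl
  sum-map-*ʳ c f (x ∷ xs) = trans (cong (f x * c +_) (sum-map-*ʳ c f xs))
                                  (sym (*-distribʳ-+ c (f x) _))

  sum-map-mono : ∀ {f g : A → ℕ} xs → (∀ x → f x ≤ g x) → sum (map f xs) ≤ sum (map g xs)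
  sum-map-mono []       f≤g = z≤n
  sum-map-mono (x ∷ xs) f≤g = +-mono-≤ (f≤g x) (sum-map-mono xs f≤g)

∑ : ∀ {n} → (Subset n → ℕ) → ℕ
∑ {n} f = sum (map f (allSubsets n))

∑-cong : ∀ {n} {f g : Subset n → ℕ} → (∀ S → f S ≡ g S) → ∑ f ≡ ∑ g
∑-cong {n} f≗g = cong sum (map-cong f≗g (allSubsets n))

∑-suc : ∀ {n} (f : Subset (suc n) → ℕ) → ∑ f ≡ ∑ (f ∘ (true ∷_)) + ∑ (f ∘ (false ∷_))
∑-suc {n} f = begin
  sum (map f (map (true ∷_) X List.++ map (false ∷_) X))
    ≡⟨ cong sum (map-++ f (map (true ∷_) X) _) ⟩
  sum (map f (map (true ∷_) X) List.++ map f (map (false ∷_) X))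
    ≡⟨ sum-++ (map f (map (true ∷_) X)) _ ⟩
  sum (map f (map (true ∷_) X)) + sum (map f (map (false ∷_) X))
    ≡⟨ cong₂ _+_ (cong sum (map-∘ X)) (cong sum (map-∘ X)) ⟨
  ∑ (f ∘ (true ∷_)) + ∑ (f ∘ (false ∷_)) ∎
  where
  open ≡-Reasoning
  X = allSubsets n

∑-++ : ∀ m {n} (f : Subset (m + n) → ℕ) → ∑ f ≡ ∑ λ (S : Subset m) → ∑ λ (U : Subset n) → f (S ++ U)
∑-++ zero    f = sym (+-identityʳ (∑ f))
∑-++ (suc m) {n} f = begin
  ∑ f                                         ≡⟨ ∑-suc f ⟩
  ∑ (f ∘ (true ∷_)) + ∑ (f ∘ (false ∷_))      ≡⟨ cong₂ _+_ (∑-++ m _) (∑-++ m _) ⟩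
  ∑ (h ∘ (true ∷_)) + ∑ (h ∘ (false ∷_))      ≡⟨ ∑-suc h ⟨
  ∑ h                                         ∎
  where
  open ≡-Reasoning
  h : Subset (suc m) → ℕ
  h S = ∑ λ (U : Subset n) → f (S ++ U)

∑-+-*ʳ : ∀ {n} (f g : Subset n → ℕ) c → ∑ (λ S → f S + g S * c) ≡ ∑ f + ∑ g * c
∑-+-*ʳ {n} f g c =
  trans (sum-map-+ f (λ S → g S * c) (allSubsets n)) (cong (∑ f +_) (sum-map-*ʳ c g (allSubsets n)))

stableCount-∑ : ∀ {n} (adj : Adj n) k → stableCount adj k ≡ ∑ λ S → 𝟙 (isStable adj S ∧ (∣ S ∣ ≡ᵇ k))
stableCount-∑ {n} adj k = length-filter-≡true (λ S → isStable adj S ∧ (∣ S ∣ ≡ᵇ k)) (allSubsets n)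

-- Binomial coefficients and Catalan numbers

[k+1]*[n+1]C[k+1]≡[n+1]*nCk : ∀ n k → suc k * (suc n C suc k) ≡ suc n * (n C k)
[k+1]*[n+1]C[k+1]≡[n+1]*nCk zero    zero    = refl
[k+1]*[n+1]C[k+1]≡[n+1]*nCk zero    (suc k) = *-zeroʳ (suc (suc k))
[k+1]*[n+1]C[k+1]≡[n+1]*nCk (suc n) zero    =
  trans (*-identityˡ _) (trans (nC1≡n (suc (suc n))) (sym (*-identityʳ _)))
[k+1]*[n+1]C[k+1]≡[n+1]*nCk (suc n) (suc k) = begin
  suc (suc k) * (suc (suc n) C suc (suc k))
    ≡⟨ cong (suc (suc k) *_) (nCk+nC[k+1]≡[n+1]C[k+1] (suc n) (suc k)) ⟨
  suc (suc k) * (A + B)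
    ≡⟨ regroup (suc k) A B ⟩
  A + (suc k * A + suc (suc k) * B)
    ≡⟨ cong (A +_) (cong₂ _+_ ([k+1]*[n+1]C[k+1]≡[n+1]*nCk n k) ([k+1]*[n+1]C[k+1]≡[n+1]*nCk n (suc k))) ⟩
  A + (suc n * (n C k) + suc n * (n C suc k))
    ≡⟨ cong (A +_) (*-distribˡ-+ (suc n) (n C k) _) ⟨
  A + suc n * (n C k + n C suc k)
    ≡⟨ cong (λ x → A + suc n * x) (nCk+nC[k+1]≡[n+1]C[k+1] n k) ⟩
  suc (suc n) * A
    ∎
  where
  open ≡-Reasoning
  A = suc n C suc k
  B = suc n C suc (suc k)
  regroup : ∀ k A B → suc k * (A + B) ≡ A + (k * A + suc k * B)
  regroup = solve-∀

[k+1]*nC[k+1]≡[n∸k]*nCk : ∀ n k → suc k * (n C suc k) ≡ (n ∸ k) * (n C k)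
[k+1]*nC[k+1]≡[n∸k]*nCk n k with ≤-<-connex k n
... | inj₂ n<k rewrite k>n⇒nCk≡0 (m<n⇒m<1+n n<k) | m≤n⇒m∸n≡0 (<⇒≤ n<k) = *-zeroʳ (suc k)
... | inj₁ k≤n = +-cancelˡ-≡ (suc k * (n C k)) _ _ (begin
    suc k * (n C k) + suc k * (n C suc k)   ≡⟨ *-distribˡ-+ (suc k) (n C k) _ ⟨
    suc k * (n C k + n C suc k)             ≡⟨ cong (suc k *_) (nCk+nC[k+1]≡[n+1]C[k+1] n k) ⟩
    suc k * (suc n C suc k)                 ≡⟨ [k+1]*[n+1]C[k+1]≡[n+1]*nCk n k ⟩
    suc n * (n C k)                         ≡⟨ cong (λ m → suc m * (n C k)) (m+[n∸m]≡n k≤n) ⟨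
    suc (k + (n ∸ k)) * (n C k)             ≡⟨ *-distribʳ-+ (n C k) (suc k) (n ∸ k) ⟩
    suc k * (n C k) + (n ∸ k) * (n C k)     ∎)
  where open ≡-Reasoning

nCk≤nC[k+1] : ∀ {n k} → suc (k + k) ≤ n → n C k ≤ n C suc k
nCk≤nC[k+1] {n} {k} 2k+1≤n = *-cancelˡ-≤ (suc k) (begin
  suc k * (n C k)          ≤⟨ *-monoˡ-≤ (n C k) (m+n≤o⇒m≤o∸n (suc k) 2k+1≤n) ⟩
  (n ∸ k) * (n C k)        ≡⟨ [k+1]*nC[k+1]≡[n∸k]*nCk n k ⟨
  suc k * (n C suc k)      ∎)
  where open ≤-Reasoning

nC[k+1]≤nCk : ∀ {n k} → n ≤ suc (k + k) → n C suc k ≤ n C k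
nC[k+1]≤nCk {n} {k} n≤2k+1 = *-cancelˡ-≤ (suc k) (begin
  suc k * (n C suc k)      ≡⟨ [k+1]*nC[k+1]≡[n∸k]*nCk n k ⟩
  (n ∸ k) * (n C k)        ≤⟨ *-monoˡ-≤ (n C k) (m≤n+o⇒m∸n≤o n k n≤k+[k+1]) ⟩
  suc k * (n C k)          ∎)
  where
  open ≤-Reasoning
  n≤k+[k+1] : n ≤ k + suc k
  n≤k+[k+1] = ≤-trans n≤2k+1 (≤-reflexive (sym (+-suc k k)))

catalan : ℕ → ℕ
catalan m = (m + m) C m ∸ (m + m) C suc m

[m+1]*catalan[m]≡[2m]Cm : ∀ m → suc m * catalan m ≡ (m + m) C m
[m+1]*catalan[m]≡[2m]Cm m = begin
  suc m * (A ∸ B)              ≡⟨ *-distribˡ-∸ (suc m) A B ⟩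
  suc m * A ∸ suc m * B        ≡⟨ cong (suc m * A ∸_) ([k+1]*nC[k+1]≡[n∸k]*nCk (m + m) m) ⟩
  A + m * A ∸ (m + m ∸ m) * A  ≡⟨ cong (λ x → A + m * A ∸ x * A) (m+n∸n≡m m m) ⟩
  A + m * A ∸ m * A            ≡⟨ m+n∸n≡m A (m * A) ⟩
  A                            ∎
  where
  open ≡-Reasoning
  A = (m + m) C m
  B = (m + m) C suc m

[2m+1]C[m+1]≡[2m+1]*catalan[m] : ∀ m → suc (m + m) C suc m ≡ suc (m + m) * catalan m
[2m+1]C[m+1]≡[2m+1]*catalan[m] m = *-cancelˡ-≡ _ _ (suc m) (begin
  suc m * (suc (m + m) C suc m)       ≡⟨ [k+1]*[n+1]C[k+1]≡[n+1]*nCk (m + m) m ⟩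
  suc (m + m) * ((m + m) C m)         ≡⟨ cong (suc (m + m) *_) ([m+1]*catalan[m]≡[2m]Cm m) ⟨
  suc (m + m) * (suc m * catalan m)   ≡⟨ *-comm-middle (suc (m + m)) (suc m) (catalan m) ⟩
  suc m * (suc (m + m) * catalan m)   ∎)
  where
  open ≡-Reasoning
  *-comm-middle : ∀ a b c → a * (b * c) ≡ b * (a * c)
  *-comm-middle = solve-∀

[m+2]*catalan[m+1]≡2[2m+1]*catalan[m] : ∀ m → suc (suc m) * catalan (suc m) ≡ 2 * suc (m + m) * catalan m
[m+2]*catalan[m+1]≡2[2m+1]*catalan[m] m = *-cancelˡ-≡ _ _ (suc m) (begin
  suc m * (suc (suc m) * catalan (suc m))   ≡⟨ cong (suc m *_) ([m+1]*catalan[m]≡[2m]Cm (suc m)) ⟩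
  suc m * ((suc m + suc m) C suc m)         ≡⟨ cong (λ x → suc m * (x C suc m)) (cong suc (+-suc m m)) ⟩
  suc m * (suc N C suc m)                   ≡⟨ [k+1]*[n+1]C[k+1]≡[n+1]*nCk N m ⟩
  suc N * (N C m)                           ≡⟨ cong (suc N *_) N-sym ⟩
  suc N * (N C suc m)                       ≡⟨ cong (suc N *_) ([2m+1]C[m+1]≡[2m+1]*catalan[m] m) ⟩
  suc N * (N * catalan m)                   ≡⟨ rearrange m (catalan m) ⟩
  suc m * (2 * N * catalan m)               ∎)
  where
  open ≡-Reasoning
  N = suc (m + m)
  N-sym : N C m ≡ N C suc m
  N-sym = trans (nCk≡nC[n∸k] (m≤n+m m (suc m))) (cong (N C_) (m+n∸n≡m (suc m) m))
  rearrange : ∀ m c → suc (suc (m + m)) * (suc (m + m) * c) ≡ suc m * (2 * suc (m + m) * c)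
  rearrange = solve-∀

catalan[m+1]≤4*catalan[m] : ∀ m → catalan (suc m) ≤ 4 * catalan m
catalan[m+1]≤4*catalan[m] m = *-cancelˡ-≤ (suc (suc m)) (begin
  suc (suc m) * catalan (suc m)                ≡⟨ [m+2]*catalan[m+1]≡2[2m+1]*catalan[m] m ⟩
  2 * suc (m + m) * catalan m                  ≤⟨ m≤m+n _ (6 * catalan m) ⟩
  2 * suc (m + m) * catalan m + 6 * catalan m  ≡⟨ rearrange m (catalan m) ⟩
  suc (suc m) * (4 * catalan m)                ∎)
  where
  open ≤-Reasoning
  rearrange : ∀ m c → 2 * suc (m + m) * c + 6 * c ≡ suc (suc m) * (4 * c)
  rearrange = solve-∀

-- shiftedC z k j is the coefficient of x^j in x^k (1 + x)^z.
shiftedC : ℕ → ℕ → ℕ → ℕ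
shiftedC z zero    j       = z C j
shiftedC z (suc k) zero    = 0
shiftedC z (suc k) (suc j) = shiftedC z k j

shiftedC-pascal : ∀ z k j → shiftedC (suc z) k j ≡ shiftedC z (suc k) j + shiftedC z k j
shiftedC-pascal z zero    zero    = refl
shiftedC-pascal z zero    (suc j) = sym (nCk+nC[k+1]≡[n+1]C[k+1] z j)
shiftedC-pascal z (suc k) zero    = refl
shiftedC-pascal z (suc k) (suc j) = shiftedC-pascal z k j

shiftedC-zero : ∀ k j → shiftedC 0 k j ≡ 𝟙 (k ≡ᵇ j)
shiftedC-zero zero    zero    = refl
shiftedC-zero zero    (suc j) = refl
shiftedC-zero (suc k) zero    = refl
shiftedC-zero (suc k) (suc j) = shiftedC-zero k j

private
  +-double-suc : ∀ z k → z + (suc k + suc k) ≡ 2 + (z + (k + k))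
  +-double-suc = solve-∀

shiftedC-increasing : ∀ z k j → suc (j + j) ≤ z + (k + k) → shiftedC z k j ≤ shiftedC z k (suc j)
shiftedC-increasing z zero    j       h = nCk≤nC[k+1] (≤-trans h (≤-reflexive (+-identityʳ z)))
shiftedC-increasing z (suc k) zero    h = z≤n
shiftedC-increasing z (suc k) (suc j) h = shiftedC-increasing z k j
  (+-cancelˡ-≤ 2 _ _ (subst₂ _≤_ (+-double-suc 1 j) (+-double-suc z k) h))

shiftedC-decreasing : ∀ z k j → z + (k + k) ≤ suc (j + j) → shiftedC z k (suc j) ≤ shiftedC z k j
shiftedC-decreasing z zero    j       h = nC[k+1]≤nCk (≤-trans (≤-reflexive (sym (+-identityʳ z))) h)
shiftedC-decreasing z (suc k) zero    h = contradiction (subst (_≤ 1) (+-double-suc z k) h) λ { (s≤s ()) }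
shiftedC-decreasing z (suc k) (suc j) h = shiftedC-decreasing z k j
  (+-cancelˡ-≤ 2 _ _ (subst₂ _≤_ (+-double-suc z k) (+-double-suc 1 j) h))

shiftedC[2p]1p≡2pC[p+1] : ∀ p → shiftedC (p + p) 1 p ≡ (p + p) C suc p
shiftedC[2p]1p≡2pC[p+1] zero    = refl
shiftedC[2p]1p≡2pC[p+1] (suc r) = trans (nCk≡nC[n∸k] r≤N) (cong (N C_) N∸r≡r+2)
  where
  N = suc r + suc r
  N≡r+[r+2] : N ≡ r + suc (suc r)
  N≡r+[r+2] = sym (+-suc r (suc r))
  r≤N : r ≤ N
  r≤N = subst (r ≤_) (sym N≡r+[r+2]) (m≤m+n r _)
  N∸r≡r+2 : N ∸ r ≡ suc (suc r)
  N∸r≡r+2 = trans (cong (_∸ r) N≡r+[r+2]) (m+n∸m≡n r _)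

private
  before-peak : ∀ {z k m} → suc k + z ≡ m + m → suc (m + m) ≤ z + (suc k + suc k)
  before-peak {z} {k} {m} e = begin
    suc (m + m)           ≡⟨ +-comm 1 (m + m) ⟩
    m + m + 1             ≤⟨ +-monoʳ-≤ (m + m) (s≤s z≤n) ⟩
    m + m + suc k         ≡⟨ cong (_+ suc k) e ⟨
    suc k + z + suc k     ≡⟨ cong (_+ suc k) (+-comm (suc k) z) ⟩
    z + suc k + suc k     ≡⟨ +-assoc z (suc k) (suc k) ⟩
    z + (suc k + suc k)   ∎
    where open ≤-Reasoning

-- From x^(p+1) to x^(p+2) only the k = 0 term decreases (by catalan (p + 1)), and the
-- k = 2 term increases by catalan p.
shiftedC-central : ∀ p z k → k + z ≡ suc p + suc p →
  shiftedC z k (suc p) + 𝟙 (k ≡ᵇ 2) * catalan p ≤ shiftedC z k (suc (suc p)) + 𝟙 (k ≡ᵇ 0) * catalan (suc p)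
shiftedC-central p _ zero refl = begin
  A + 0               ≡⟨ +-identityʳ A ⟩
  A                   ≤⟨ m≤n+m∸n A B ⟩
  B + (A ∸ B)         ≡⟨ cong (B +_) (+-identityʳ (A ∸ B)) ⟨
  B + 1 * (A ∸ B)     ∎
  where
  open ≤-Reasoning
  A = (suc p + suc p) C suc p
  B = (suc p + suc p) C suc (suc p)
shiftedC-central p z 2 e with suc-injective (trans (suc-injective e) (+-suc p p))
... | refl = begin
  shiftedC (p + p) 1 p + 1 * (A ∸ B)  ≡⟨ cong₂ _+_ (shiftedC[2p]1p≡2pC[p+1] p) (+-identityʳ (A ∸ B)) ⟩
  B + (A ∸ B)                         ≡⟨ m+[n∸m]≡n (nC[k+1]≤nCk (n≤1+n (p + p))) ⟩
  A                                   ≡⟨ +-identityʳ A ⟨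
  A + 0                               ∎
  where
  open ≤-Reasoning
  A = (p + p) C p
  B = (p + p) C suc p
shiftedC-central p z 1 e = +-monoˡ-≤ 0 (shiftedC-increasing z 1 (suc p) (before-peak {m = suc p} e))
shiftedC-central p z k@(suc (suc (suc _))) e =
  +-monoˡ-≤ 0 (shiftedC-increasing z k (suc p) (before-peak {m = suc p} e))

∑-⊆-size≡shiftedC : ∀ {n} (R : Subset n) k j →
  ∑ (λ U → 𝟙 (does (U ⊆? R) ∧ (k + ∣ U ∣ ≡ᵇ j))) ≡ shiftedC ∣ R ∣ k j
∑-⊆-size≡shiftedC [] k j = begin
  𝟙 (k + 0 ≡ᵇ j) + 0  ≡⟨ +-identityʳ _ ⟩
  𝟙 (k + 0 ≡ᵇ j)      ≡⟨ cong (λ m → 𝟙 (m ≡ᵇ j)) (+-identityʳ k) ⟩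
  𝟙 (k ≡ᵇ j)          ≡⟨ shiftedC-zero k j ⟨
  shiftedC 0 k j      ∎
  where open ≡-Reasoning
∑-⊆-size≡shiftedC {suc n} (true ∷ R) k j = begin
  ∑ (count k)
    ≡⟨ ∑-suc (count k) ⟩
  ∑ (count k ∘ (true ∷_)) + ∑ (count k ∘ (false ∷_))
    ≡⟨ cong (_+ ∑ (count k ∘ (false ∷_))) (∑-cong λ U →
         cong (λ m → 𝟙 (does (U ⊆? R) ∧ (m ≡ᵇ j))) (+-suc k ∣ U ∣)) ⟩
  ∑ (count (suc k) ∘ (false ∷_)) + ∑ (count k ∘ (false ∷_))
    ≡⟨ cong₂ _+_ (∑-⊆-size≡shiftedC R (suc k) j) (∑-⊆-size≡shiftedC R k j) ⟩
  shiftedC r (suc k) j + shiftedC r k j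
    ≡⟨ shiftedC-pascal r k j ⟨
  shiftedC (suc r) k j
    ∎
  where
  open ≡-Reasoning
  r = ∣ R ∣
  count : ℕ → Subset (suc n) → ℕ
  count k U = 𝟙 (does (U ⊆? (true ∷ R)) ∧ (k + ∣ U ∣ ≡ᵇ j))
∑-⊆-size≡shiftedC {suc n} (false ∷ R) k j =
  trans (∑-suc {n} _) (cong₂ _+_ (sum-map-0 (allSubsets n)) (∑-⊆-size≡shiftedC R k j))

-- Stable sets

Independent : ∀ {n} → Adj n → Subset n → Set
Independent adj S = ∀ {i j} → i ∈ S → j ∈ S → adj i j ≡ false

module _ {n} (adj : Adj n) (S : Subset n) where

  private
    entry : Fin n → Fin n → Bool
    entry i j = not (lookup S i ∧ lookup S j ∧ adj i j)

  isStable⇒Independent : isStable adj S ≡ true → Independent adj S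
  isStable⇒Independent stable {i} {j} i∈S j∈S = Equivalence.to T-not-≡
    (subst₂ (λ a b → T (not (a ∧ b ∧ adj i j))) ([]=⇒lookup i∈S) ([]=⇒lookup j∈S) entry-ok)
    where
    row-ok : T (all (entry i) (allFin n))
    row-ok = All.lookup (all⁺ (λ i → all (entry i) (allFin n)) (allFin n) (Equivalence.from T-≡ stable))
                        (∈-allFin i)
    entry-ok : T (entry i j)
    entry-ok = All.lookup (all⁺ (entry i) (allFin n) row-ok) (∈-allFin j)

  Independent⇒isStable : Independent adj S → isStable adj S ≡ true
  Independent⇒isStable independent = Equivalence.to T-≡
    (all⁻ (λ i → all (entry i) (allFin n)) {allFin n}
      (All.tabulate λ {i} _ → all⁻ (entry i) {allFin n} (All.tabulate λ {j} _ → entry-ok i j)))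
    where
    entry-ok : ∀ i j → T (entry i j)
    entry-ok i j with lookup S i in si | lookup S j in sj
    ... | false | _     = _
    ... | true  | false = _
    ... | true  | true  = Equivalence.from T-not-≡ (independent (lookup⇒[]= i S si) (lookup⇒[]= j S sj))

isStable-⊆ : ∀ {n} {adj : Adj n} {S R : Subset n} → S ⊆ R → isStable adj R ≡ true → isStable adj S ≡ true
isStable-⊆ {adj = adj} {S} {R} S⊆R stable =
  Independent⇒isStable adj S λ i∈S j∈S → isStable⇒Independent adj R stable (S⊆R i∈S) (S⊆R j∈S)

isStable-⊥ : ∀ {n} {adj : Adj n} → isStable adj ⊥ ≡ true
isStable-⊥ {adj = adj} = Independent⇒isStable adj ⊥ λ i∈⊥ → contradiction i∈⊥ ∉⊥

module _ {m n} {S : Subset m} {U : Subset n} where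

  ∈-++⁺ˡ : ∀ {i} → i ∈ S → i ↑ˡ n ∈ S ++ U
  ∈-++⁺ˡ {i} i∈S = lookup⇒[]= _ _ (trans (lookup-++ˡ S U i) ([]=⇒lookup i∈S))

  ∈-++⁺ʳ : ∀ {i} → i ∈ U → m ↑ʳ i ∈ S ++ U
  ∈-++⁺ʳ {i} i∈U = lookup⇒[]= _ _ (trans (lookup-++ʳ S U i) ([]=⇒lookup i∈U))

  ∈-++⁻ : ∀ x → x ∈ S ++ U → [ _∈ S , _∈ U ]′ (splitAt m x)
  ∈-++⁻ x x∈ with splitAt m x | lookup-splitAt m S U x
  ... | inj₁ i | eq = lookup⇒[]= i S (trans (sym eq) ([]=⇒lookup x∈))
  ... | inj₂ i | eq = lookup⇒[]= i U (trans (sym eq) ([]=⇒lookup x∈))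

∣p++q∣≡∣p∣+∣q∣ : ∀ {m n} (p : Subset m) (q : Subset n) → ∣ p ++ q ∣ ≡ ∣ p ∣ + ∣ q ∣
∣p++q∣≡∣p∣+∣q∣ []          q = refl
∣p++q∣≡∣p∣+∣q∣ (true ∷ p)  q = cong suc (∣p++q∣≡∣p∣+∣q∣ p q)
∣p++q∣≡∣p∣+∣q∣ (false ∷ p) q = ∣p++q∣≡∣p∣+∣q∣ p q

∣∁p∣+∣p∣≡n : ∀ {n} (p : Subset n) → ∣ ∁ p ∣ + ∣ p ∣ ≡ n
∣∁p∣+∣p∣≡n p = trans (cong (_+ ∣ p ∣) (∣∁p∣≡n∸∣p∣ p)) (m∸n+n≡m (∣p∣≤n p))

∣∁p∣+[∣p∣+∣p∣]≡n+∣p∣ : ∀ {n} (p : Subset n) → ∣ ∁ p ∣ + (∣ p ∣ + ∣ p ∣) ≡ n + ∣ p ∣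
∣∁p∣+[∣p∣+∣p∣]≡n+∣p∣ p = trans (sym (+-assoc (∣ ∁ p ∣) _ _)) (cong (_+ ∣ p ∣) (∣∁p∣+∣p∣≡n p))

stableCount≤nCk : ∀ {n} (adj : Adj n) k → stableCount adj k ≤ n C k
stableCount≤nCk {n} adj k = begin
  stableCount adj k                                          ≡⟨ stableCount-∑ adj k ⟩
  ∑ (λ S → 𝟙 (isStable adj S ∧ (∣ S ∣ ≡ᵇ k)))                ≤⟨ sum-map-mono (allSubsets n) below ⟩
  ∑ (λ (S : Subset n) → 𝟙 (does (S ⊆? ⊤) ∧ (∣ S ∣ ≡ᵇ k)))   ≡⟨ ∑-⊆-size≡shiftedC (⊤ {n}) 0 k ⟩
  ∣ ⊤ {n} ∣ C k                                              ≡⟨ cong (_C k) (∣⊤∣≡n n) ⟩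
  n C k                                                      ∎
  where
  open ≤-Reasoning
  below : ∀ S → 𝟙 (isStable adj S ∧ (∣ S ∣ ≡ᵇ k)) ≤ 𝟙 (does (S ⊆? ⊤) ∧ (∣ S ∣ ≡ᵇ k))
  below S rewrite dec-true (S ⊆? ⊤) ⊆⊤ = 𝟙[a∧b]≤𝟙[b] (isStable adj S) _

∣R∣Ck≤stableCount : ∀ {n} (adj : Adj n) R → isStable adj R ≡ true → ∀ k → ∣ R ∣ C k ≤ stableCount adj k
∣R∣Ck≤stableCount {n} adj R stable k = begin
  ∣ R ∣ C k                                        ≡⟨ ∑-⊆-size≡shiftedC R 0 k ⟨
  ∑ (λ S → 𝟙 (does (S ⊆? R) ∧ (∣ S ∣ ≡ᵇ k)))       ≤⟨ sum-map-mono (allSubsets n) above ⟩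
  ∑ (λ S → 𝟙 (isStable adj S ∧ (∣ S ∣ ≡ᵇ k)))      ≡⟨ stableCount-∑ adj k ⟨
  stableCount adj k                                ∎
  where
  open ≤-Reasoning
  above : ∀ S → 𝟙 (does (S ⊆? R) ∧ (∣ S ∣ ≡ᵇ k)) ≤ 𝟙 (isStable adj S ∧ (∣ S ∣ ≡ᵇ k))
  above S with S ⊆? R
  ... | yes S⊆R rewrite isStable-⊆ S⊆R stable = ≤-refl
  ... | no  _   = z≤n

-- Stable sets of G*

module _ {n} (G : Adj n) where

  star-↑ˡ-↑ˡ : ∀ i j → star G (i ↑ˡ n) (j ↑ˡ n) ≡ G i j
  star-↑ˡ-↑ˡ i j rewrite splitAt-↑ˡ n i n | splitAt-↑ˡ n j n = refl

  star-pendant-edge : ∀ i → star G (i ↑ˡ n) (n ↑ʳ i) ≡ true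
  star-pendant-edge i rewrite splitAt-↑ˡ n i n | splitAt-↑ʳ n n i =
    trans (isYes≗does (i ≟ i)) (dec-true (i ≟ i) refl)

  star-Independent⁺ : ∀ {S U} → Independent G S → U ⊆ ∁ S → Independent (star G) (S ++ U)
  star-Independent⁺ {S} {U} independent U⊆∁S {x} {y} x∈ y∈
    with splitAt n x | splitAt n y | ∈-++⁻ {S = S} {U} x x∈ | ∈-++⁻ {S = S} {U} y y∈
  ... | inj₁ i | inj₁ j | i∈S | j∈S = independent i∈S j∈S
  ... | inj₁ i | inj₂ j | i∈S | j∈U =
    trans (isYes≗does (i ≟ j)) (dec-false (i ≟ j) λ { refl → x∈p⇒x∉∁p i∈S (U⊆∁S j∈U) })
  ... | inj₂ i | inj₁ j | i∈U | j∈S =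
    trans (isYes≗does (i ≟ j)) (dec-false (i ≟ j) λ { refl → x∈p⇒x∉∁p j∈S (U⊆∁S i∈U) })
  ... | inj₂ i | inj₂ j | _   | _   = refl

  star-Independent⁻ : ∀ {S U} → Independent (star G) (S ++ U) → Independent G S × U ⊆ ∁ S
  star-Independent⁻ independent =
    (λ {i} {j} i∈S j∈S → trans (sym (star-↑ˡ-↑ˡ i j)) (independent (∈-++⁺ˡ i∈S) (∈-++⁺ˡ j∈S))) ,
    (λ {i} i∈U → x∉p⇒x∈∁p λ i∈S →
      true≢false (trans (sym (star-pendant-edge i)) (independent (∈-++⁺ˡ i∈S) (∈-++⁺ʳ i∈U))))
    where
    true≢false : true ≢ false
    true≢false ()

  isStable-star : ∀ S U → isStable (star G) (S ++ U) ≡ isStable G S ∧ does (U ⊆? ∁ S)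
  isStable-star S U with isStable G S in stable-S | U ⊆? ∁ S
  ... | true  | yes U⊆∁S =
    Independent⇒isStable (star G) (S ++ U) (star-Independent⁺ (isStable⇒Independent G S stable-S) U⊆∁S)
  ... | true  | no  U⊈∁S = ¬-not λ stable →
    U⊈∁S (proj₂ (star-Independent⁻ (isStable⇒Independent (star G) (S ++ U) stable)))
  ... | false | _        = ¬-not λ stable → not-¬ stable-S
    (Independent⇒isStable G S (proj₁ (star-Independent⁻ (isStable⇒Independent (star G) (S ++ U) stable))))

  pendants-stable : isStable (star G) (⊥ {n} ++ ⊤) ≡ true
  pendants-stable = trans (isStable-star ⊥ ⊤)
    (cong₂ _∧_ (isStable-⊥ {adj = G}) (dec-true (⊤ {n} ⊆? ∁ ⊥) λ _ → x∉p⇒x∈∁p ∉⊥))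

  n≤α[star] : ∀ {d} → (∀ W → isStable (star G) W ≡ true → ∣ W ∣ ≤ d) → n ≤ d
  n≤α[star] {d} maximal = subst (_≤ d) ∣⊥++⊤∣≡n (maximal (⊥ {n} ++ ⊤) pendants-stable)
    where
    ∣⊥++⊤∣≡n : ∣ ⊥ {n} ++ ⊤ {n} ∣ ≡ n
    ∣⊥++⊤∣≡n = trans (∣p++q∣≡∣p∣+∣q∣ (⊥ {n}) ⊤) (cong₂ _+_ (∣⊥∣≡0 n) (∣⊤∣≡n n))

  starTerm : ℕ → Subset n → ℕ
  starTerm j S = if isStable G S then shiftedC (∣ ∁ S ∣) (∣ S ∣) j else 0

  stableCount-star : ∀ j → stableCount (star G) j ≡ ∑ (starTerm j)
  stableCount-star j = begin
    stableCount (star G) j                                          ≡⟨ stableCount-∑ (star G) j ⟩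
    ∑ (λ W → 𝟙 (isStable (star G) W ∧ (∣ W ∣ ≡ᵇ j)))                ≡⟨ ∑-++ n _ ⟩
    ∑ (λ (S : Subset n) → ∑ λ (U : Subset n) → 𝟙 (isStable (star G) (S ++ U) ∧ (∣ S ++ U ∣ ≡ᵇ j)))
                                                                    ≡⟨ ∑-cong pendants ⟩
    ∑ (starTerm j)                                                  ∎
    where
    open ≡-Reasoning
    pendants : ∀ S → ∑ (λ U → 𝟙 (isStable (star G) (S ++ U) ∧ (∣ S ++ U ∣ ≡ᵇ j))) ≡ starTerm j S
    pendants S = trans
      (∑-cong λ U → cong₂ (λ b m → 𝟙 (b ∧ (m ≡ᵇ j))) (isStable-star S U) (∣p++q∣≡∣p∣+∣q∣ S U))
      (by-stability (isStable G S))
      where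
      by-stability : ∀ b → ∑ (λ U → 𝟙 ((b ∧ does (U ⊆? ∁ S)) ∧ (∣ S ∣ + ∣ U ∣ ≡ᵇ j)))
                           ≡ (if b then shiftedC (∣ ∁ S ∣) (∣ S ∣) j else 0)
      by-stability true  = ∑-⊆-size≡shiftedC (∁ S) ∣ S ∣ j
      by-stability false = sum-map-0 (allSubsets n)

  stableCount-star-≤ : ∀ {j j′} →
    (∀ S → isStable G S ≡ true → shiftedC (∣ ∁ S ∣) (∣ S ∣) j ≤ shiftedC (∣ ∁ S ∣) (∣ S ∣) j′) →
    stableCount (star G) j ≤ stableCount (star G) j′
  stableCount-star-≤ {j} {j′} termwise =
    subst₂ _≤_ (sym (stableCount-star j)) (sym (stableCount-star j′)) (sum-map-mono (allSubsets n) by-stability)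
    where
    by-stability : ∀ S → starTerm j S ≤ starTerm j′ S
    by-stability S with isStable G S in stable
    ... | true  = termwise S stable
    ... | false = z≤n

  stableCount-star-increasing : ∀ j → suc (j + j) ≤ n → stableCount (star G) j ≤ stableCount (star G) (suc j)
  stableCount-star-increasing j 2j+1≤n = stableCount-star-≤ λ S _ →
    shiftedC-increasing (∣ ∁ S ∣) (∣ S ∣) j (begin
      suc (j + j)                  ≤⟨ 2j+1≤n ⟩
      n                            ≤⟨ m≤m+n n ∣ S ∣ ⟩
      n + ∣ S ∣                    ≡⟨ ∣∁p∣+[∣p∣+∣p∣]≡n+∣p∣ S ⟨
      ∣ ∁ S ∣ + (∣ S ∣ + ∣ S ∣)    ∎)
    where open ≤-Reasoning

  stableCount-star-decreasing : ∀ {a} → (∀ S → isStable G S ≡ true → ∣ S ∣ ≤ a) →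
    ∀ j → n + a ≤ suc (j + j) → stableCount (star G) (suc j) ≤ stableCount (star G) j
  stableCount-star-decreasing {a} α≤a j n+a≤2j+1 = stableCount-star-≤ λ S stable →
    shiftedC-decreasing (∣ ∁ S ∣) (∣ S ∣) j (begin
      ∣ ∁ S ∣ + (∣ S ∣ + ∣ S ∣)    ≡⟨ ∣∁p∣+[∣p∣+∣p∣]≡n+∣p∣ S ⟩
      n + ∣ S ∣                    ≤⟨ +-monoʳ-≤ n (α≤a S stable) ⟩
      n + a                        ≤⟨ n+a≤2j+1 ⟩
      suc (j + j)                  ∎)
    where open ≤-Reasoning

  stableCount-star-central : ∀ p → n ≡ suc p + suc p →
    stableCount (star G) (suc p) + stableCount G 2 * catalan p
      ≤ stableCount (star G) (suc (suc p)) + stableCount G 0 * catalan (suc p)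
  stableCount-star-central p n≡2p+2 = begin
    stableCount (star G) (suc p) + stableCount G 2 * catalan p
      ≡⟨ cong₂ (λ a b → a + b * catalan p) (stableCount-star (suc p)) (stableCount-∑ G 2) ⟩
    ∑ (starTerm (suc p)) + ∑ (stableOfSize 2) * catalan p
      ≡⟨ ∑-+-*ʳ (starTerm (suc p)) (stableOfSize 2) (catalan p) ⟨
    ∑ (λ S → starTerm (suc p) S + stableOfSize 2 S * catalan p)
      ≤⟨ sum-map-mono (allSubsets n) termwise ⟩
    ∑ (λ S → starTerm (suc (suc p)) S + stableOfSize 0 S * catalan (suc p))
      ≡⟨ ∑-+-*ʳ (starTerm (suc (suc p))) (stableOfSize 0) (catalan (suc p)) ⟩
    ∑ (starTerm (suc (suc p))) + ∑ (stableOfSize 0) * catalan (suc p)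
      ≡⟨ cong₂ (λ a b → a + b * catalan (suc p)) (stableCount-star (suc (suc p))) (stableCount-∑ G 0) ⟨
    stableCount (star G) (suc (suc p)) + stableCount G 0 * catalan (suc p)
      ∎
    where
    open ≤-Reasoning
    stableOfSize : ℕ → Subset n → ℕ
    stableOfSize k S = 𝟙 (isStable G S ∧ (∣ S ∣ ≡ᵇ k))
    termwise : ∀ S → starTerm (suc p) S + stableOfSize 2 S * catalan p
                     ≤ starTerm (suc (suc p)) S + stableOfSize 0 S * catalan (suc p)
    termwise S with isStable G S
    ... | true  = shiftedC-central p (∣ ∁ S ∣) (∣ S ∣) (trans (+-comm ∣ S ∣ _) (trans (∣∁p∣+∣p∣≡n S) n≡2p+2))
    ... | false = z≤n

  stableCount-star-central-increasing : ∀ p → n ≡ suc p + suc p →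
    ∀ T → isStable G T ≡ true → ∣ T ∣ ≡ 4 → stableCount (star G) (suc p) ≤ stableCount (star G) (suc (suc p))
  stableCount-star-central-increasing p n≡2p+2 T T-stable ∣T∣≡4 =
    +-cancelʳ-≤ (6 * catalan p) _ _ (begin
    c (suc p) + 6 * catalan p                            ≤⟨ +-monoʳ-≤ _ (*-monoˡ-≤ (catalan p) 6≤s₂) ⟩
    c (suc p) + stableCount G 2 * catalan p              ≤⟨ stableCount-star-central p n≡2p+2 ⟩
    c (suc (suc p)) + stableCount G 0 * catalan (suc p)  ≤⟨ +-monoʳ-≤ _ (*-monoˡ-≤ (catalan (suc p)) s₀≤1) ⟩
    c (suc (suc p)) + 1 * catalan (suc p)                ≡⟨ cong (c (suc (suc p)) +_) (*-identityˡ _) ⟩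
    c (suc (suc p)) + catalan (suc p)                    ≤⟨ +-monoʳ-≤ _ (catalan[m+1]≤4*catalan[m] p) ⟩
    c (suc (suc p)) + 4 * catalan p                      ≤⟨ +-monoʳ-≤ (c (suc (suc p))) (*-monoˡ-≤ (catalan p) (m≤m+n 4 2)) ⟩
    c (suc (suc p)) + 6 * catalan p                      ∎)
    where
    open ≤-Reasoning
    c : ℕ → ℕ
    c = stableCount (star G)
    6≤s₂ : 6 ≤ stableCount G 2
    6≤s₂ = subst (λ m → m C 2 ≤ stableCount G 2) ∣T∣≡4 (∣R∣Ck≤stableCount G T T-stable 2)
    s₀≤1 : stableCount G 0 ≤ 1
    s₀≤1 = stableCount≤nCk G 0

-- Modes

ModeIn : (ℕ → ℕ) → ℕ → ℕ → ℕ → Set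
ModeIn a d lo hi = Σ ℕ λ k → IsMode a d k × lo ≤ k × k ≤ hi

ModeIn-weaken : ∀ {a d lo hi lo′ hi′} → lo′ ≤ lo → hi ≤ hi′ → ModeIn a d lo hi → ModeIn a d lo′ hi′
ModeIn-weaken lo′≤lo hi≤hi′ (k , mode , lo≤k , k≤hi) = k , mode , ≤-trans lo′≤lo lo≤k , ≤-trans k≤hi hi≤hi′

unimodal-around⇒ModeIn : ∀ (a : ℕ → ℕ) d L →
  (∀ j → j < L → a j ≤ a (suc j)) → (∀ j → L < j → a (suc j) ≤ a j) → L < d → ModeIn a d L (suc L)
unimodal-around⇒ModeIn a d L up down L<d with a (suc L) ≤? a L
... | yes a[L+1]≤a[L] = L , (<⇒≤ L<d , up , down′) , ≤-refl , n≤1+n L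
  where
  down′ : ∀ i → L ≤ i → suc i ≤ d → a (suc i) ≤ a i
  down′ i L≤i _ with m≤n⇒m<n∨m≡n L≤i
  ... | inj₁ L<i = down i L<i
  ... | inj₂ refl = a[L+1]≤a[L]
... | no a[L+1]≰a[L] = suc L , (L<d , up′ , λ i L<i _ → down i L<i) , n≤1+n L , ≤-refl
  where
  up′ : ∀ i → suc i ≤ suc L → a i ≤ a (suc i)
  up′ i i<1+L with m≤n⇒m<n∨m≡n (s≤s⁻¹ i<1+L)
  ... | inj₁ i<L  = up i i<L
  ... | inj₂ refl = <⇒≤ (≰⇒> a[L+1]≰a[L])

data Parity : ℕ → Set where
  even : ∀ q → Parity (q + q)
  odd  : ∀ q → Parity (suc (q + q))

parity : ∀ n → Parity n
parity zero    = even zero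
parity (suc n) with parity n
... | even q = odd q
... | odd  q = subst Parity (cong suc (+-suc q q)) (even (suc q))

[2+m]/2≡1+m/2 : ∀ m → suc (suc m) / 2 ≡ suc (m / 2)
[2+m]/2≡1+m/2 m = m/n≡1+[m∸n]/n {suc (suc m)} (s≤s (s≤s z≤n))

[q+q]/2≡q : ∀ q → (q + q) / 2 ≡ q
[q+q]/2≡q zero    = refl
[q+q]/2≡q (suc q) = trans (cong (λ m → suc m / 2) (+-suc q q))
  (trans ([2+m]/2≡1+m/2 (q + q)) (cong suc ([q+q]/2≡q q)))

[2+q+q]/2≡1+q : ∀ q → suc (suc (q + q)) / 2 ≡ suc q
[2+q+q]/2≡1+q q = trans ([2+m]/2≡1+m/2 (q + q)) (cong suc ([q+q]/2≡q q))

[1+q+q]/2≡q : ∀ q → suc (q + q) / 2 ≡ q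
[1+q+q]/2≡q zero    = refl
[1+q+q]/2≡q (suc q) = trans (cong (λ m → suc (suc m) / 2) (+-suc q q))
  (trans ([2+m]/2≡1+m/2 (suc (q + q))) (cong suc ([1+q+q]/2≡q q)))

[q+q]%2≡0 : ∀ q → (q + q) % 2 ≡ 0
[q+q]%2≡0 zero    = refl
[q+q]%2≡0 (suc q) = trans (cong (λ m → suc m % 2) (+-suc q q)) ([q+q]%2≡0 q)

private
  [q+q]+4≡[q+2]+[q+2] : ∀ q → q + q + 4 ≡ suc (suc q) + suc (suc q)
  [q+q]+4≡[q+2]+[q+2] = solve-∀

mode-odd : ∀ q (G : Adj (suc (q + q))) → (∀ S → isStable G S ≡ true → ∣ S ∣ ≤ 4) →
  4 ≤ suc (q + q) → ∀ {d} → suc (q + q) ≤ d → ModeIn (stableCount (star G)) d (suc q) (suc (suc q))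
mode-odd q G α≤4 4≤n {d} n≤d = unimodal-around⇒ModeIn _ d (suc q) up down (≤-trans (q+2≤n q 4≤n) n≤d)
  where
  up : ∀ j → j < suc q → stableCount (star G) j ≤ stableCount (star G) (suc j)
  up j j<1+q = stableCount-star-increasing G j (s≤s (+-mono-≤ (s≤s⁻¹ j<1+q) (s≤s⁻¹ j<1+q)))
  down : ∀ j → suc q < j → stableCount (star G) (suc j) ≤ stableCount (star G) j
  down j q+2≤j = stableCount-star-decreasing G α≤4 j
    (s≤s (≤-trans (≤-reflexive ([q+q]+4≡[q+2]+[q+2] q)) (+-mono-≤ q+2≤j q+2≤j)))
  q+2≤n : ∀ q → 4 ≤ suc (q + q) → suc (suc q) ≤ suc (q + q)
  q+2≤n zero    (s≤s ())
  q+2≤n (suc q) _ = s≤s (s≤s (m≤n+m (suc q) q))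

mode-even : ∀ p (G : Adj (suc p + suc p)) → (∀ S → isStable G S ≡ true → ∣ S ∣ ≤ 4) →
  ∀ T → isStable G T ≡ true → ∣ T ∣ ≡ 4 → 4 ≤ suc p + suc p →
  ∀ {d} → suc p + suc p ≤ d → ModeIn (stableCount (star G)) d (suc (suc p)) (suc (suc (suc p)))
mode-even p G α≤4 T T-stable ∣T∣≡4 4≤n {d} n≤d =
  unimodal-around⇒ModeIn _ d (suc (suc p)) up down (≤-trans (p+3≤n p 4≤n) n≤d)
  where
  up : ∀ j → j < suc (suc p) → stableCount (star G) j ≤ stableCount (star G) (suc j)
  up j j<2+p with m≤n⇒m<n∨m≡n (s≤s⁻¹ j<2+p)
  ... | inj₁ j<1+p = stableCount-star-increasing G j (+-mono-≤ j<1+p (<⇒≤ j<1+p))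
  ... | inj₂ refl  = stableCount-star-central-increasing G p refl T T-stable ∣T∣≡4
  down : ∀ j → suc (suc p) < j → stableCount (star G) (suc j) ≤ stableCount (star G) j
  down j p+3≤j = stableCount-star-decreasing G α≤4 j
    (≤-trans (≤-reflexive ([q+q]+4≡[q+2]+[q+2] (suc p))) (≤-trans (+-mono-≤ p+3≤j p+3≤j) (n≤1+n (j + j))))
  p+3≤n : ∀ p → 4 ≤ suc p + suc p → suc (suc (suc p)) ≤ suc p + suc p
  p+3≤n zero    (s≤s (s≤s ()))
  p+3≤n (suc p) _ = s≤s (s≤s (m≤n+m (suc (suc p)) p))

theorem4 : (n : ℕ) (G : Adj n) → IsSimpleGraph G → IsIndependenceNumber G 4 →
    (d : ℕ) → IsIndependenceNumber (star G) d →
    Σ ℕ (λ k → IsMode (stableCount (star G)) d k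
                 × ((suc n / 2) ≤ k) × (k ≤ (suc n / 2) + 2))
    × (n % 2 ≡ 1 → Σ ℕ (λ k → IsMode (stableCount (star G)) d k
                 × ((suc n / 2) ≤ k) × (k ≤ (suc n / 2) + 1)))
theorem4 n G _ ((T , T-stable , ∣T∣≡4) , α≤4) d (_ , maximal)
  with parity n | subst (_≤ n) ∣T∣≡4 (∣p∣≤n T) | n≤α[star] G maximal
... | even zero    | ()  | _
... | even (suc p) | 4≤n | n≤d rewrite [1+q+q]/2≡q (suc p) =
  ModeIn-weaken (n≤1+n _) (≤-reflexive (+-comm 2 (suc p))) (mode-even p G α≤4 T T-stable ∣T∣≡4 4≤n n≤d) ,
  λ odd → contradiction (trans (sym ([q+q]%2≡0 (suc p))) odd) λ ()
... | odd q        | 4≤n | n≤d rewrite [2+q+q]/2≡1+q q =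
  ModeIn-weaken ≤-refl (+-monoʳ-≤ (suc q) (n≤1+n 1)) mode , λ _ → mode
  where
  mode : ModeIn (stableCount (star G)) d (suc q) (suc q + 1)
  mode = ModeIn-weaken ≤-refl (≤-reflexive (+-comm 1 (suc q))) (mode-odd q G α≤4 4≤n n≤d)
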